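{- Let $k\geq 1$ be an integer, $G$ a group, and $X\leq P$ two subgroups of $G$ such that: (1) $C_G^i(X)=C_G^i(P)$ for all $i\in\{0,\dots,k-1\}$; (2) $[\gamma_k(P),C_G^k(X)]=1$; (3) $C_G(X)=C_G(P)$. Then $C_G^k(X)=C_G^k(P)$.
   Context: For a subgroup $P$ of a group $G$, the iterated centralizers of $P$ in $G$ are defined by $C_G^0(P)=1$ and, for $n\geq 1$, $C_G^n(P)=\{x\in\bigcap_{k<n}N_G(C_G^k(P)) : [x,P]\subseteq C_G^{n-1}(P)\}$. Commutators: $[g,h]=g^{ -1}h^{ -1}gh$; for subsets $A,B$, $[A,B]$ is the subgroup generated by all $[a,b]$, $a\in A,b\in B$. Lower central series: $\gamma_1(P)=P$, $\gamma_{k+1}(P)=[\gamma_k(P),P]$. -}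

module Defs where

open import Level using (Level; _⊔_; Lift)
open import Algebra.Bundles using (Group)
open import Data.Nat using (ℕ; zero; suc)
open import Data.Product using (Σ; _×_; ∃; _,_)
open import Data.Unit.Polymorphic using (⊤)
open import Relation.Unary using (Pred; _⊆_; _≐_)

module GroupDefs {c ℓ : Level} (G : Group c ℓ) where
  open Group G

  ⁅_,_⁆ : Carrier → Carrier → Carrier
  ⁅ g , h ⁆ = ((g ⁻¹ ∙ h ⁻¹) ∙ g) ∙ h

  record IsSubgroup {p : Level} (H : Pred Carrier p) : Set (c ⊔ ℓ ⊔ p) where
    field
      resp   : ∀ {x y} → x ≈ y → H x → H y
      ε-mem  : H ε
      ∙-mem  : ∀ {x y} → H x → H y → H (x ∙ y)
      ⁻¹-mem : ∀ {x} → H x → H (x ⁻¹)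

  data ⟨_⟩ {s : Level} (S : Pred Carrier s) : Pred Carrier (c ⊔ ℓ ⊔ s) where
    gen  : ∀ {x} → S x → ⟨ S ⟩ x
    one  : ⟨ S ⟩ ε
    mul  : ∀ {x y} → ⟨ S ⟩ x → ⟨ S ⟩ y → ⟨ S ⟩ (x ∙ y)
    inv  : ∀ {x} → ⟨ S ⟩ x → ⟨ S ⟩ (x ⁻¹)
    resp : ∀ {x y} → x ≈ y → ⟨ S ⟩ x → ⟨ S ⟩ y

  ⁅_⸴_⁆ : {a b : Level} → Pred Carrier a → Pred Carrier b → Pred Carrier (c ⊔ ℓ ⊔ a ⊔ b)
  ⁅ A ⸴ B ⁆ = ⟨ (λ g → Σ Carrier λ x → Σ Carrier λ y → A x × B y × g ≈ ⁅ x , y ⁆) ⟩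

  Triv : Pred Carrier ℓ
  Triv x = x ≈ ε

  -- lower central series: γ (suc 0) = P, γ (suc (suc n)) = [γ (suc n), P].
  -- (γ 0 is set to P as a harmless convention; it is never used.)
  γ : {p : Level} → Pred Carrier p → ℕ → Pred Carrier (c ⊔ ℓ ⊔ p)
  γ {p} P zero          = λ x → Lift (c ⊔ ℓ) (P x)
  γ {p} P (suc zero)    = λ x → Lift (c ⊔ ℓ) (P x)
  γ {p} P (suc (suc n)) = ⁅ γ P (suc n) ⸴ P ⁆

  Centralizer : {p : Level} → Pred Carrier p → Pred Carrier (c ⊔ ℓ ⊔ p)
  Centralizer X g = ∀ x → X x → g ∙ x ≈ x ∙ g

  Normalizes : {h : Level} → Pred Carrier h → Pred Carrier (c ⊔ ℓ ⊔ h)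
  Normalizes H x =
    (∀ h → H h → Σ Carrier λ h' → H h' × ((x ⁻¹ ∙ h) ∙ x) ≈ h')
    × (∀ h → H h → Σ Carrier λ h' → H h' × h ≈ ((x ⁻¹ ∙ h') ∙ x))

  -- iterated centralizers C^n_G(P), together with
  -- NAll P n x  :=  x ∈ ⋂_{k<n} N_G(C^k_G(P))
  mutual
    IC : {p : Level} → Pred Carrier p → ℕ → Pred Carrier (c ⊔ ℓ ⊔ p)
    IC {p} P zero    = λ x → Lift (c ⊔ p) (x ≈ ε)
    IC {p} P (suc n) = λ x →
      (NAll P n x × Normalizes (IC P n) x)
      × (∀ y → ⟨ (λ g → Σ Carrier λ q → P q × g ≈ ⁅ x , q ⁆) ⟩ y → IC P n y)

    NAll : {p : Level} → Pred Carrier p → ℕ → Pred Carrier (c ⊔ ℓ ⊔ p)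
    NAll P zero    = λ x → ⊤
    NAll P (suc n) = λ x → NAll P n x × Normalizes (IC P n) x

module Submission where

-- The inclusion C^k(P) ⊆ C^k(X) is formal: both sides normalize the same
-- C^i for i < k, and X ⊆ P.  For the converse take x ∈ C^k(X).  The heart of
-- the proof is that [x, γ_{j+1}(P)] ⊆ C^t(P) whenever j + 1 + t = k; for
-- j = 0, t = k - 1 this says x ∈ C^k(P).  It is proved by induction on t:
-- for t = 0 it is the hypothesis [γ_k(P), C^k(X)] = 1; for t + 1 one shows [x, g] ∈ C^{t+1}(X)
-- (which equals C^{t+1}(P)) by controlling [[x, g], q] for q ∈ X with the
-- three subgroups lemma, the other two terms being handled by the induction
-- hypothesis and by the general fact [C^{j+1+t}(P), γ_{j+1}(P)] ⊆ C^t(P).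

open import Defs
open import Level using (Level; lift)
open import Algebra.Bundles using (Group)
import Algebra.Properties.Group as GroupProperties
open import Data.Nat using (ℕ; zero; suc; _+_; _≤_; _<_; s≤s; _≤′_; ≤′-refl; ≤′-step)
open import Data.Nat.Properties using (+-suc; +-identityʳ; m≤n+m; n<1+n; m<n⇒m<1+n; <-trans; <⇒≤; ≤⇒≤′; suc-injective)
open import Data.Fin as Fin using (Fin; zero; suc)
open import Data.Vec using (Vec; lookup; []; _∷_)
open import Data.List using (List; []; _∷_)
open import Data.Bool using (Bool; true; false; not)
open import Data.Product using (Σ; _×_; _,_; proj₁; proj₂; swap)
open import Relation.Nullary using (yes; no)
open import Relation.Unary using (Pred; _⊆_; _≐_)
open import Relation.Binary.PropositionalEquality as PE using (_≡_)

-- Identities valid in every group are decided by free reduction: an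
-- expression over n variables is flattened into a freely reduced word in the
-- letters x_i^{±1}; expressions with equal reduced words are equal in G.
module FreeGroupSolver {c ℓ : Level} (G : Group c ℓ) where
  open Group G
  open GroupProperties G using (ε⁻¹≈ε; ⁻¹-involutive; ⁻¹-anti-homo-∙; \\-leftDividesˡ; \\-leftDividesʳ)
  open import Relation.Binary.Reasoning.Setoid setoid

  infixl 7 _:∙_
  infix 8 _:⁻¹

  data Expr (n : ℕ) : Set where
    var  : Fin n → Expr n
    :ε   : Expr n
    _:∙_ : Expr n → Expr n → Expr n
    _:⁻¹ : Expr n → Expr n

  v₀ : ∀ {n} → Expr (suc n)
  v₀ = var zero
  v₁ : ∀ {n} → Expr (suc (suc n))
  v₁ = var (suc zero)
  v₂ : ∀ {n} → Expr (suc (suc (suc n)))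
  v₂ = var (suc (suc zero))

  data Letter (n : ℕ) : Set where
    pos neg : Fin n → Letter n

  module _ {n : ℕ} (ρ : Fin n → Carrier) where
    ⟦_⟧ : Expr n → Carrier
    ⟦ var i ⟧  = ρ i
    ⟦ :ε ⟧     = ε
    ⟦ a :∙ b ⟧ = ⟦ a ⟧ ∙ ⟦ b ⟧
    ⟦ a :⁻¹ ⟧  = ⟦ a ⟧ ⁻¹

    ⟦_⟧ₗ : Letter n → Carrier
    ⟦ pos i ⟧ₗ = ρ i
    ⟦ neg i ⟧ₗ = ρ i ⁻¹

    ⟦_⟧w : List (Letter n) → Carrier
    ⟦ [] ⟧w    = ε
    ⟦ l ∷ w ⟧w = ⟦ l ⟧ₗ ∙ ⟦ w ⟧w

  push : ∀ {n} → Letter n → List (Letter n) → List (Letter n)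
  push (pos i) (neg j ∷ w) with i Fin.≟ j
  ... | yes _ = w
  ... | no _  = pos i ∷ neg j ∷ w
  push (neg i) (pos j ∷ w) with i Fin.≟ j
  ... | yes _ = w
  ... | no _  = neg i ∷ pos j ∷ w
  push l w = l ∷ w

  push-sound : ∀ {n} (ρ : Fin n → Carrier) l w → ⟦ ρ ⟧w (push l w) ≈ ⟦ ρ ⟧ₗ l ∙ ⟦ ρ ⟧w w
  push-sound ρ (pos i) (neg j ∷ w) with i Fin.≟ j
  ... | yes PE.refl = sym (\\-leftDividesˡ (ρ i) _)
  ... | no _        = refl
  push-sound ρ (neg i) (pos j ∷ w) with i Fin.≟ j
  ... | yes PE.refl = sym (\\-leftDividesʳ (ρ i) _)
  ... | no _        = refl
  push-sound ρ (pos i) []          = refl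
  push-sound ρ (pos i) (pos j ∷ w) = refl
  push-sound ρ (neg i) []          = refl
  push-sound ρ (neg i) (neg j ∷ w) = refl

  signed : Bool → Carrier → Carrier
  signed true  a = a
  signed false a = a ⁻¹

  nf : ∀ {n} → Bool → Expr n → List (Letter n) → List (Letter n)
  nf true  (var i)  w = push (pos i) w
  nf false (var i)  w = push (neg i) w
  nf s     :ε       w = w
  nf true  (a :∙ b) w = nf true a (nf true b w)
  nf false (a :∙ b) w = nf false b (nf false a w)
  nf s     (a :⁻¹)  w = nf (not s) a w

  nf-sound : ∀ {n} (ρ : Fin n → Carrier) s e w → ⟦ ρ ⟧w (nf s e w) ≈ signed s (⟦ ρ ⟧ e) ∙ ⟦ ρ ⟧w w
  nf-sound ρ true  (var i) w = push-sound ρ (pos i) w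
  nf-sound ρ false (var i) w = push-sound ρ (neg i) w
  nf-sound ρ true  :ε w      = sym (identityˡ _)
  nf-sound ρ false :ε w      = sym (trans (∙-congʳ ε⁻¹≈ε) (identityˡ _))
  nf-sound ρ true (a :∙ b) w = begin
    ⟦ ρ ⟧w (nf true a (nf true b w))   ≈⟨ nf-sound ρ true a _ ⟩
    ⟦ ρ ⟧ a ∙ ⟦ ρ ⟧w (nf true b w)     ≈⟨ ∙-congˡ (nf-sound ρ true b w) ⟩
    ⟦ ρ ⟧ a ∙ (⟦ ρ ⟧ b ∙ ⟦ ρ ⟧w w)     ≈⟨ assoc _ _ _ ⟨
    ⟦ ρ ⟧ a ∙ ⟦ ρ ⟧ b ∙ ⟦ ρ ⟧w w       ∎
  nf-sound ρ false (a :∙ b) w = begin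
    ⟦ ρ ⟧w (nf false b (nf false a w))      ≈⟨ nf-sound ρ false b _ ⟩
    ⟦ ρ ⟧ b ⁻¹ ∙ ⟦ ρ ⟧w (nf false a w)      ≈⟨ ∙-congˡ (nf-sound ρ false a w) ⟩
    ⟦ ρ ⟧ b ⁻¹ ∙ (⟦ ρ ⟧ a ⁻¹ ∙ ⟦ ρ ⟧w w)    ≈⟨ assoc _ _ _ ⟨
    ⟦ ρ ⟧ b ⁻¹ ∙ ⟦ ρ ⟧ a ⁻¹ ∙ ⟦ ρ ⟧w w      ≈⟨ ∙-congʳ (⁻¹-anti-homo-∙ _ _) ⟨
    (⟦ ρ ⟧ a ∙ ⟦ ρ ⟧ b) ⁻¹ ∙ ⟦ ρ ⟧w w       ∎
  nf-sound ρ true  (a :⁻¹) w = nf-sound ρ false a w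
  nf-sound ρ false (a :⁻¹) w = trans (nf-sound ρ true a w) (∙-congʳ (sym (⁻¹-involutive _)))

  normalise : ∀ {n} → Expr n → List (Letter n)
  normalise e = nf true e []

  solve : ∀ {n} (l r : Expr n) → normalise l ≡ normalise r → (xs : Vec Carrier n)
        → ⟦ lookup xs ⟧ l ≈ ⟦ lookup xs ⟧ r
  solve l r same xs = begin
    ⟦ ρ ⟧ l               ≈⟨ identityʳ _ ⟨
    ⟦ ρ ⟧ l ∙ ε           ≈⟨ nf-sound ρ true l [] ⟨
    ⟦ ρ ⟧w (normalise l)  ≡⟨ PE.cong ⟦ ρ ⟧w same ⟩
    ⟦ ρ ⟧w (normalise r)  ≈⟨ nf-sound ρ true r [] ⟩
    ⟦ ρ ⟧ r ∙ ε           ≈⟨ identityʳ _ ⟩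
    ⟦ ρ ⟧ r               ∎
    where ρ = lookup xs

module CommutatorCalculus {c ℓ : Level} (G : Group c ℓ) where
  open Group G
  open GroupDefs G using (⁅_,_⁆)
  open FreeGroupSolver G

  infixl 7.5 _^_ _:^_

  _^_ : Carrier → Carrier → Carrier
  h ^ z = z ⁻¹ ∙ h ∙ z

  private
    _:^_ : ∀ {n} → Expr n → Expr n → Expr n
    a :^ z = z :⁻¹ :∙ a :∙ z

    :⁅_,_⁆ : ∀ {n} → Expr n → Expr n → Expr n
    :⁅ a , b ⁆ = a :⁻¹ :∙ b :⁻¹ :∙ a :∙ b

  ^-cong : ∀ {h h' z z'} → h ≈ h' → z ≈ z' → h ^ z ≈ h' ^ z'
  ^-cong eh ez = ∙-cong (∙-cong (⁻¹-cong ez) eh) ez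

  comm-cong : ∀ {a a' b b'} → a ≈ a' → b ≈ b' → ⁅ a , b ⁆ ≈ ⁅ a' , b' ⁆
  comm-cong ea eb = ∙-cong (∙-cong (∙-cong (⁻¹-cong ea) (⁻¹-cong eb)) ea) eb

  ^-ε : ∀ h → h ^ ε ≈ h
  ^-ε h = solve (v₀ :^ :ε) v₀ PE.refl (h ∷ [])

  ε-^ : ∀ z → ε ^ z ≈ ε
  ε-^ z = solve (:ε :^ v₀) :ε PE.refl (z ∷ [])

  ^-∙ : ∀ h x y → h ^ (x ∙ y) ≈ h ^ x ^ y
  ^-∙ h x y = solve (v₀ :^ (v₁ :∙ v₂)) (v₀ :^ v₁ :^ v₂) PE.refl (h ∷ x ∷ y ∷ [])

  ^-^⁻¹ : ∀ h z → h ^ z ^ z ⁻¹ ≈ h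
  ^-^⁻¹ h z = solve (v₀ :^ v₁ :^ v₁ :⁻¹) v₀ PE.refl (h ∷ z ∷ [])

  ^⁻¹-^ : ∀ h z → h ^ z ⁻¹ ^ z ≈ h
  ^⁻¹-^ h z = solve (v₀ :^ v₁ :⁻¹ :^ v₁) v₀ PE.refl (h ∷ z ∷ [])

  ^-as-comm : ∀ h z → h ^ z ≈ h ∙ ⁅ h , z ⁆
  ^-as-comm h z = solve (v₀ :^ v₁) (v₀ :∙ :⁅ v₀ , v₁ ⁆) PE.refl (h ∷ z ∷ [])

  comm-swap : ∀ a b → ⁅ a , b ⁆ ≈ ⁅ b , a ⁆ ⁻¹
  comm-swap a b = solve :⁅ v₀ , v₁ ⁆ (:⁅ v₁ , v₀ ⁆ :⁻¹) PE.refl (a ∷ b ∷ [])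

  comm-εˡ : ∀ b → ⁅ ε , b ⁆ ≈ ε
  comm-εˡ b = solve :⁅ :ε , v₀ ⁆ :ε PE.refl (b ∷ [])

  comm-εʳ : ∀ a → ⁅ a , ε ⁆ ≈ ε
  comm-εʳ a = solve :⁅ v₀ , :ε ⁆ :ε PE.refl (a ∷ [])

  comm-∙ˡ : ∀ x y b → ⁅ x ∙ y , b ⁆ ≈ ⁅ x , b ⁆ ^ y ∙ ⁅ y , b ⁆
  comm-∙ˡ x y b = solve :⁅ v₀ :∙ v₁ , v₂ ⁆ (:⁅ v₀ , v₂ ⁆ :^ v₁ :∙ :⁅ v₁ , v₂ ⁆) PE.refl (x ∷ y ∷ b ∷ [])

  comm-⁻¹ˡ : ∀ x b → ⁅ x ⁻¹ , b ⁆ ≈ ⁅ x , b ⁆ ⁻¹ ^ x ⁻¹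
  comm-⁻¹ˡ x b = solve :⁅ v₀ :⁻¹ , v₁ ⁆ (:⁅ v₀ , v₁ ⁆ :⁻¹ :^ v₀ :⁻¹) PE.refl (x ∷ b ∷ [])

  comm-∙ʳ : ∀ a x y → ⁅ a , x ∙ y ⁆ ≈ ⁅ a , y ⁆ ∙ ⁅ a , x ⁆ ^ y
  comm-∙ʳ a x y = solve :⁅ v₀ , v₁ :∙ v₂ ⁆ (:⁅ v₀ , v₂ ⁆ :∙ :⁅ v₀ , v₁ ⁆ :^ v₂) PE.refl (a ∷ x ∷ y ∷ [])

  comm-⁻¹ʳ : ∀ a x → ⁅ a , x ⁻¹ ⁆ ≈ ⁅ a , x ⁆ ⁻¹ ^ x ⁻¹
  comm-⁻¹ʳ a x = solve :⁅ v₀ , v₁ :⁻¹ ⁆ (:⁅ v₀ , v₁ ⁆ :⁻¹ :^ v₁ :⁻¹) PE.refl (a ∷ x ∷ [])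

  comm-⁻¹-flip : ∀ a x → ⁅ a , x ⁻¹ ⁆ ≈ ⁅ x , a ⁆ ^ x ⁻¹
  comm-⁻¹-flip a x = solve :⁅ v₀ , v₁ :⁻¹ ⁆ (:⁅ v₁ , v₀ ⁆ :^ v₁ :⁻¹) PE.refl (a ∷ x ∷ [])

  hall-witt : ∀ a b d → ⁅ ⁅ d , a ⁻¹ ⁆ , b ⁆
            ≈ (⁅ ⁅ b , d ⁻¹ ⁆ , a ⁆ ⁻¹ ^ d ∙ ⁅ ⁅ a , b ⁻¹ ⁆ , d ⁆ ⁻¹ ^ b) ^ a ⁻¹
  hall-witt a b d = solve :⁅ :⁅ v₂ , v₀ :⁻¹ ⁆ , v₁ ⁆
    ((:⁅ :⁅ v₁ , v₂ :⁻¹ ⁆ , v₀ ⁆ :⁻¹ :^ v₂ :∙ :⁅ :⁅ v₀ , v₁ :⁻¹ ⁆ , v₂ ⁆ :⁻¹ :^ v₁) :^ v₀ :⁻¹)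
    PE.refl (a ∷ b ∷ d ∷ [])

module SubgroupTheory {c ℓ : Level} (G : Group c ℓ) where
  open Group G
  open GroupDefs G
  open CommutatorCalculus G

  ⟨⟩-least : ∀ {s h} {S : Pred Carrier s} {H : Pred Carrier h} → IsSubgroup H → S ⊆ H → ⟨ S ⟩ ⊆ H
  ⟨⟩-least SH S⊆H (gen s)    = S⊆H s
  ⟨⟩-least SH S⊆H one        = IsSubgroup.ε-mem SH
  ⟨⟩-least SH S⊆H (mul a b)  = IsSubgroup.∙-mem SH (⟨⟩-least SH S⊆H a) (⟨⟩-least SH S⊆H b)
  ⟨⟩-least SH S⊆H (inv a)    = IsSubgroup.⁻¹-mem SH (⟨⟩-least SH S⊆H a)
  ⟨⟩-least SH S⊆H (resp e a) = IsSubgroup.resp SH e (⟨⟩-least SH S⊆H a)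

  ⟨⟩-mono : ∀ {s t} {S : Pred Carrier s} {T : Pred Carrier t} → S ⊆ T → ⟨ S ⟩ ⊆ ⟨ T ⟩
  ⟨⟩-mono S⊆T (gen s)    = gen (S⊆T s)
  ⟨⟩-mono S⊆T one        = one
  ⟨⟩-mono S⊆T (mul a b)  = mul (⟨⟩-mono S⊆T a) (⟨⟩-mono S⊆T b)
  ⟨⟩-mono S⊆T (inv a)    = inv (⟨⟩-mono S⊆T a)
  ⟨⟩-mono S⊆T (resp e a) = resp e (⟨⟩-mono S⊆T a)

  ∩-sub : ∀ {a b} {A : Pred Carrier a} {B : Pred Carrier b}
        → IsSubgroup A → IsSubgroup B → IsSubgroup (λ g → A g × B g)
  ∩-sub SA SB = record
    { resp   = λ e (a , b) → IsSubgroup.resp SA e a , IsSubgroup.resp SB e b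
    ; ε-mem  = IsSubgroup.ε-mem SA , IsSubgroup.ε-mem SB
    ; ∙-mem  = λ (a , b) (a' , b') → IsSubgroup.∙-mem SA a a' , IsSubgroup.∙-mem SB b b'
    ; ⁻¹-mem = λ (a , b) → IsSubgroup.⁻¹-mem SA a , IsSubgroup.⁻¹-mem SB b
    }

  module _ {h : Level} {H : Pred Carrier h} (SH : IsSubgroup H) where
    open IsSubgroup SH using (∙-mem; ⁻¹-mem)

    comm-mem : ∀ {a b} → H a → H b → H ⁅ a , b ⁆
    comm-mem Ha Hb = ∙-mem (∙-mem (∙-mem (⁻¹-mem Ha) (⁻¹-mem Hb)) Ha) Hb

    ^-mem : ∀ {a z} → H a → H z → H (a ^ z)
    ^-mem Ha Hz = ∙-mem (∙-mem (⁻¹-mem Hz) Ha) Hz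

    comm-flip-mem : ∀ {a b} → H ⁅ a , b ⁆ → H ⁅ b , a ⁆
    comm-flip-mem {a} {b} H[a,b] = IsSubgroup.resp SH (sym (comm-swap b a)) (⁻¹-mem H[a,b])

  Norm-resp : ∀ {h} {N : Pred Carrier h} {z z'} → z ≈ z' → Normalizes N z → Normalizes N z'
  Norm-resp e (f , g) =
    (λ k Nk → let (k' , Nk' , eq) = f k Nk in k' , Nk' , trans (^-cong refl (sym e)) eq) ,
    (λ k Nk → let (k' , Nk' , eq) = g k Nk in k' , Nk' , trans eq (^-cong refl e))

  Norm-ext : ∀ {h h'} {N : Pred Carrier h} {M : Pred Carrier h'} {z} → N ≐ M → Normalizes N z → Normalizes M z
  Norm-ext (N⊆M , M⊆N) (f , g) =
    (λ k Mk → let (k' , Nk' , eq) = f k (M⊆N Mk) in k' , N⊆M Nk' , eq) ,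
    (λ k Mk → let (k' , Nk' , eq) = g k (M⊆N Mk) in k' , N⊆M Nk' , eq)

  -- For ≈-closed N, z normalizes N iff N is stable under conjugation by z and z⁻¹;
  -- hence the normalizer of N is a subgroup.
  module Normalizer {h : Level} {N : Pred Carrier h} (N-resp : ∀ {x y} → x ≈ y → N x → N y) where
    ConjStable : Carrier → Set _
    ConjStable z = ∀ {k} → N k → N (k ^ z)

    stable : ∀ {z} → Normalizes N z → ConjStable z
    stable (f , _) {k} Nk = let (k' , Nk' , eq) = f k Nk in N-resp (sym eq) Nk'

    stable⁻¹ : ∀ {z} → Normalizes N z → ConjStable (z ⁻¹)
    stable⁻¹ {z} (_ , g) {k} Nk =
      let (k' , Nk' , eq) = g k Nk in N-resp (sym (trans (^-cong eq refl) (^-^⁻¹ k' z))) Nk'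

    fromStable : ∀ {z} → ConjStable z → ConjStable (z ⁻¹) → Normalizes N z
    fromStable {z} st st⁻ = (λ k Nk → k ^ z , st Nk , refl) , (λ k Nk → k ^ z ⁻¹ , st⁻ Nk , sym (^⁻¹-^ k z))

    Normalizer-sub : IsSubgroup (Normalizes N)
    Normalizer-sub = record
      { resp   = Norm-resp
      ; ε-mem  = fromStable (λ {k} Nk → N-resp (sym (^-ε k)) Nk)
                            (λ {k} Nk → N-resp (sym (trans (^-cong refl ε⁻¹≈ε) (^-ε k))) Nk)
      ; ∙-mem  = λ {x} {y} nx ny → fromStable
          (λ {k} Nk → N-resp (sym (^-∙ k x y)) (stable ny (stable nx Nk)))
          (λ {k} Nk → N-resp (trans (sym (^-∙ k (y ⁻¹) (x ⁻¹))) (^-cong refl (sym (⁻¹-anti-homo-∙ x y))))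
                             (stable⁻¹ nx (stable⁻¹ ny Nk)))
      ; ⁻¹-mem = λ {x} nx → fromStable (stable⁻¹ nx)
          (λ {k} Nk → N-resp (^-cong refl (sym (⁻¹-involutive x))) (stable nx Nk))
      }
      where open GroupProperties G using (ε⁻¹≈ε; ⁻¹-anti-homo-∙; ⁻¹-involutive)

  module _ {h : Level} {N : Pred Carrier h} (SN : IsSubgroup N) where
    open IsSubgroup SN using (∙-mem; ⁻¹-mem) renaming (resp to N-resp)
    open Normalizer N-resp

    self-normalizes : ∀ {z} → N z → Normalizes N z
    self-normalizes Nz = fromStable (λ Nk → ^-mem SN Nk Nz) (λ Nk → ^-mem SN Nk (⁻¹-mem Nz))

    three-subgroups : ∀ {a b d} → Normalizes N a → Normalizes N b → Normalizes N d
      → N ⁅ ⁅ a , b ⁻¹ ⁆ , d ⁆ → N ⁅ ⁅ b , d ⁻¹ ⁆ , a ⁆ → N ⁅ ⁅ d , a ⁻¹ ⁆ , b ⁆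
    three-subgroups {a} {b} {d} na nb nd N₁ N₂ = N-resp (sym (hall-witt a b d))
      (stable⁻¹ na (∙-mem (stable nd (⁻¹-mem N₂)) (stable nb (⁻¹-mem N₁))))

    comm-preimage-sub : ∀ {p} {P : Pred Carrier p} → IsSubgroup P → (∀ {q} → P q → Normalizes N q)
                      → ∀ d → IsSubgroup (λ g → P g × N ⁅ d , g ⁆)
    comm-preimage-sub SP P-norm d = record
      { resp   = λ e (Pg , N[d,g]) → IsSubgroup.resp SP e Pg , N-resp (comm-cong refl e) N[d,g]
      ; ε-mem  = IsSubgroup.ε-mem SP , N-resp (sym (comm-εʳ d)) (IsSubgroup.ε-mem SN)
      ; ∙-mem  = λ {g} {g'} (Pg , N[d,g]) (Pg' , N[d,g']) → IsSubgroup.∙-mem SP Pg Pg' ,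
          N-resp (sym (comm-∙ʳ d g g')) (∙-mem N[d,g'] (stable (P-norm Pg') N[d,g]))
      ; ⁻¹-mem = λ {g} (Pg , N[d,g]) → IsSubgroup.⁻¹-mem SP Pg ,
          N-resp (sym (comm-⁻¹ʳ d g)) (stable⁻¹ (P-norm Pg) (⁻¹-mem N[d,g]))
      }

module IteratedCentralizers {c ℓ p : Level} (G : Group c ℓ) (P : Pred (Group.Carrier G) p) where
  open Group G
  open GroupDefs G
  open CommutatorCalculus G
  open SubgroupTheory G

  NAll-resp : ∀ n {x y} → x ≈ y → NAll P n x → NAll P n y
  NAll-resp zero    e _       = _
  NAll-resp (suc n) e (nx , z) = NAll-resp n e nx , Norm-resp e z

  IC-resp : ∀ n {x y} → x ≈ y → IC P n x → IC P n y
  IC-resp zero    e (lift x≈ε)  = lift (trans (sym e) x≈ε)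
  IC-resp (suc n) e (nx , comm) = NAll-resp (suc n) e nx ,
    (λ w w∈[y,P] → comm w (⟨⟩-mono (λ (q , Pq , eq) → q , Pq , trans eq (comm-cong (sym e) refl)) w∈[y,P]))

  NAll-sub : ∀ n → IsSubgroup (NAll P n)
  NAll-sub zero    = record { resp = λ _ _ → _ ; ε-mem = _ ; ∙-mem = λ _ _ → _ ; ⁻¹-mem = λ _ → _ }
  NAll-sub (suc n) = ∩-sub (NAll-sub n) (Normalizer.Normalizer-sub (IC-resp n))

  NAll-≤′ : ∀ {i n} → i ≤′ n → NAll P n ⊆ NAll P i
  NAll-≤′ ≤′-refl       nz        = nz
  NAll-≤′ (≤′-step i≤n) (nz , _) = NAll-≤′ i≤n nz

  NAll-≤ : ∀ {i n} → i ≤ n → NAll P n ⊆ NAll P i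
  NAll-≤ i≤n = NAll-≤′ (≤⇒≤′ i≤n)

  NAll-normalizes : ∀ {i n z} → i < n → NAll P n z → Normalizes (IC P i) z
  NAll-normalizes i<n nz = proj₂ (NAll-≤ i<n nz)

  IC-elim : ∀ n {z} → IC P (suc n) z → ∀ {q} → P q → IC P n ⁅ z , q ⁆
  IC-elim n (_ , comm) {q} Pq = comm _ (gen (q , Pq , refl))

  mutual
    IC-intro : ∀ n {z} → NAll P (suc n) z → (∀ {q} → P q → IC P n ⁅ z , q ⁆) → IC P (suc n) z
    IC-intro n nz comm = nz , λ w w∈[z,P] →
      ⟨⟩-least (IC-sub n) (λ (q , Pq , eq) → IC-resp n (sym eq) (comm Pq)) w∈[z,P]

    IC-sub : ∀ n → IsSubgroup (IC P n)
    IC-sub zero = record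
      { resp   = IC-resp zero
      ; ε-mem  = lift refl
      ; ∙-mem  = λ (lift x≈ε) (lift y≈ε) → lift (trans (∙-cong x≈ε y≈ε) (identityˡ ε))
      ; ⁻¹-mem = λ (lift x≈ε) → lift (trans (⁻¹-cong x≈ε) ε⁻¹≈ε)
      }
      where open GroupProperties G using (ε⁻¹≈ε)
    IC-sub (suc n) = record
      { resp   = IC-resp (suc n)
      ; ε-mem  = IC-intro n (IsSubgroup.ε-mem (NAll-sub (suc n)))
          (λ {q} _ → respₙ (sym (comm-εˡ q)) (IsSubgroup.ε-mem (IC-sub n)))
      ; ∙-mem  = λ {x} {y} hx hy → IC-intro n (IsSubgroup.∙-mem (NAll-sub (suc n)) (proj₁ hx) (proj₁ hy))
          (λ {q} Pq → respₙ (sym (comm-∙ˡ x y q))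
             (IsSubgroup.∙-mem (IC-sub n) (stable (proj₂ (proj₁ hy)) (IC-elim n hx Pq)) (IC-elim n hy Pq)))
      ; ⁻¹-mem = λ {x} hx → IC-intro n (IsSubgroup.⁻¹-mem (NAll-sub (suc n)) (proj₁ hx))
          (λ {q} Pq → respₙ (sym (comm-⁻¹ˡ x q))
             (stable⁻¹ (proj₂ (proj₁ hx)) (IsSubgroup.⁻¹-mem (IC-sub n) (IC-elim n hx Pq))))
      }
      where
        respₙ : ∀ {x y} → x ≈ y → IC P n x → IC P n y
        respₙ = IC-resp n
        open Normalizer respₙ using (stable; stable⁻¹)

  IC-mono : ∀ n → IC P n ⊆ IC P (suc n)
  IC-mono zero {z} (lift z≈ε) =
    IC-intro zero (NAll-resp 1 (sym z≈ε) (IsSubgroup.ε-mem (NAll-sub 1)))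
      (λ {q} _ → lift (trans (comm-cong z≈ε refl) (comm-εˡ q)))
  IC-mono (suc n) hz =
    IC-intro (suc n) (proj₁ hz , self-normalizes (IC-sub (suc n)) hz) (λ Pq → IC-mono n (IC-elim n hz Pq))

  module _ (SP : IsSubgroup P) where
    P-stable : ∀ n {q k} → P q → IC P n k → IC P n (k ^ q)
    P-stable zero    {q} _  (lift k≈ε) = lift (trans (^-cong k≈ε refl) (ε-^ q))
    P-stable (suc n) {q} {k} Pq hk = IC-resp (suc n) (sym (^-as-comm k q))
      (IsSubgroup.∙-mem (IC-sub (suc n)) hk (IC-mono n (IC-elim n hk Pq)))

    P-normalizes : ∀ n {q} → P q → Normalizes (IC P n) q
    P-normalizes n Pq = Normalizer.fromStable (IC-resp n) (P-stable n Pq) (P-stable n (IsSubgroup.⁻¹-mem SP Pq))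

    P⊆NAll : ∀ n → P ⊆ NAll P n
    P⊆NAll zero    _  = _
    P⊆NAll (suc n) Pq = P⊆NAll n Pq , P-normalizes n Pq

    γ⊆P : ∀ j → γ P (suc j) ⊆ P
    γ⊆P zero    (lift Pg) = Pg
    γ⊆P (suc j) g∈γ       = ⟨⟩-least SP
      (λ (g' , q , g'∈γ , Pq , eq) → IsSubgroup.resp SP (sym eq) (comm-mem SP (γ⊆P j g'∈γ) Pq)) g∈γ

    γ-⁻¹ : ∀ j {g} → γ P (suc j) g → γ P (suc j) (g ⁻¹)
    γ-⁻¹ zero    (lift Pg) = lift (IsSubgroup.⁻¹-mem SP Pg)
    γ-⁻¹ (suc j) g∈γ       = inv g∈γ

    -- [C^{j+1+t}(P), γ_{j+1}(P)] ⊆ C^t(P), by induction on j: the g ∈ P with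
    -- [d, g] ∈ C^t(P) form a subgroup, which contains the generators [g', q]
    -- of γ_{j+2}(P) by the three subgroups lemma and the induction hypothesis.
    comm-IC-γ : ∀ j t {d g} → IC P (suc j + t) d → γ P (suc j) g → IC P t ⁅ d , g ⁆
    comm-IC-γ zero    t hd (lift Pg) = IC-elim t hd Pg
    comm-IC-γ (suc j) t {d} hd g∈γ =
      proj₂ (⟨⟩-least (comm-preimage-sub (IC-sub t) SP (P-normalizes t) d) generators g∈γ)
      where
        open IsSubgroup (IC-sub t) using () renaming (resp to resp-t)
        open GroupProperties G using (⁻¹-involutive)

        d⁻¹∈C : IC P (suc (suc j + t)) (d ⁻¹)
        d⁻¹∈C = IsSubgroup.⁻¹-mem (IC-sub (suc (suc j + t))) hd

        d∈C : IC P (suc j + suc t) d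
        d∈C = PE.subst (λ n → IC P n d) (PE.cong suc (PE.sym (+-suc j t))) hd

        generator : ∀ {g' q} → γ P (suc j) g' → P q → IC P t ⁅ d , ⁅ g' , q ⁆ ⁆
        generator {g'} {q} g'∈γ Pq = resp-t (comm-cong refl (comm-cong refl (⁻¹-involutive q)))
          (comm-flip-mem (IC-sub t) (three-subgroups (IC-sub t)
            (P-normalizes t Pq⁻¹)
            (NAll-normalizes (s≤s (m≤n+m t (suc j))) (proj₁ hd))
            (P-normalizes t (γ⊆P j g'∈γ))
            (comm-IC-γ j t (comm-flip-mem (IC-sub (suc j + t)) (IC-elim (suc j + t) d⁻¹∈C Pq⁻¹)) g'∈γ)
            (IC-elim t (comm-IC-γ j (suc t) d∈C (γ-⁻¹ j g'∈γ)) Pq⁻¹)))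
          where Pq⁻¹ = IsSubgroup.⁻¹-mem SP Pq

        generators : (λ g → Σ Carrier λ g' → Σ Carrier λ q → γ P (suc j) g' × P q × g ≈ ⁅ g' , q ⁆)
                   ⊆ (λ g → P g × IC P t ⁅ d , g ⁆)
        generators (g' , q , g'∈γ , Pq , eq) =
          IsSubgroup.resp SP (sym eq) (comm-mem SP (γ⊆P j g'∈γ) Pq) ,
          resp-t (comm-cong refl (sym eq)) (generator g'∈γ Pq)

module Transfer {c ℓ x p : Level} (G : Group c ℓ)
    (X : Pred (Group.Carrier G) x) (P : Pred (Group.Carrier G) p) where
  open Group G
  open GroupDefs G
  open CommutatorCalculus G
  open SubgroupTheory G
  open GroupProperties G using (ε⁻¹≈ε; ⁻¹-involutive)
  module ICX = IteratedCentralizers G X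
  module ICP = IteratedCentralizers G P

  NAll-transfer : ∀ n → (∀ i → i < n → IC X i ≐ IC P i) → NAll X n ≐ NAll P n
  NAll-transfer zero    _     = (λ _ → _) , (λ _ → _)
  NAll-transfer (suc n) agree =
      (λ (nz , z) → proj₁ below nz , Norm-ext (agree n (n<1+n n)) z)
    , (λ (nz , z) → proj₂ below nz , Norm-ext (swap (agree n (n<1+n n))) z)
    where
      below : NAll X n ≐ NAll P n
      below = NAll-transfer n (λ i i<n → agree i (m<n⇒m<1+n i<n))

  module _ (X⊆P : X ⊆ P) (m : ℕ) (agree : ∀ i → i < suc m → IC X i ≐ IC P i) where
    -- the formal inclusion: centralizing modulo C^m against P implies against X
    IC-P⊆IC-X : IC P (suc m) ⊆ IC X (suc m)
    IC-P⊆IC-X (nz , comm) = proj₂ (NAll-transfer (suc m) agree) nz ,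
      λ w w∈[z,X] → proj₂ (agree m (n<1+n m)) (comm w (⟨⟩-mono (λ (q , Xq , eq) → q , X⊆P Xq , eq) w∈[z,X]))

    module _ (SP : IsSubgroup P) (comm-trivial : ⁅ γ P (suc m) ⸴ IC X (suc m) ⁆ ⊆ Triv) where
      open ICP using (IC-resp; IC-sub; NAll-normalizes; P-normalizes; γ⊆P; γ-⁻¹; comm-IC-γ)

      module _ {x : Carrier} (hx : IC X (suc m) x) where
        x-normalizes : NAll P (suc m) x
        x-normalizes = proj₁ (NAll-transfer (suc m) agree) (proj₁ hx)

        comm-x-γ : ∀ t j → suc j + t ≡ suc m → ∀ {g} → γ P (suc j) g → IC P t ⁅ x , g ⁆
        comm-x-γ zero j j+1≡k {g} g∈γ = lift (begin
            ⁅ x , g ⁆     ≈⟨ comm-swap x g ⟩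
            ⁅ g , x ⁆ ⁻¹  ≈⟨ ⁻¹-cong [g,x]≈ε ⟩
            ε ⁻¹          ≈⟨ ε⁻¹≈ε ⟩
            ε             ∎)
          where
            open import Relation.Binary.Reasoning.Setoid setoid
            g∈γₖ : γ P (suc m) g
            g∈γₖ = PE.subst (λ n → γ P n g) (PE.trans (PE.sym (+-identityʳ (suc j))) j+1≡k) g∈γ
            [g,x]≈ε : ⁅ g , x ⁆ ≈ ε
            [g,x]≈ε = comm-trivial (gen (g , x , g∈γₖ , hx , refl))
        comm-x-γ (suc t) j j+1+t+1≡k {g} g∈γ = proj₁ (agree (suc t) t+1<k) [x,g]∈C^X
          where
            t+1<k : suc t < suc m
            t+1<k = PE.subst (suc t <_) j+1+t+1≡k (s≤s (m≤n+m (suc t) j))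
            t<k : t < suc m
            t<k = <-trans (n<1+n t) t+1<k
            m≡j+1+t : m ≡ suc j + t
            m≡j+1+t = PE.trans (PE.sym (suc-injective j+1+t+1≡k)) (+-suc j t)
            Pg : P g
            Pg = γ⊆P SP j g∈γ
            -- [[x, g], q] ∈ C^t(P) for q ∈ X: of the other two Hall–Witt terms, one
            -- is handled by the induction hypothesis (for γ_{j+2}), the other by
            -- [C^m(P), γ_{j+1}(P)] ⊆ C^t(P), since [q, x⁻¹] ∈ C^m(X) = C^m(P)
            [[x,g],q]∈C : ∀ {q} → X q → IC P t ⁅ ⁅ x , g ⁆ , q ⁆
            [[x,g],q]∈C {q} Xq = IC-resp t (comm-cong (comm-cong refl (⁻¹-involutive g)) refl)
                (three-subgroups (IC-sub t)
                  (P-normalizes SP t (IsSubgroup.⁻¹-mem SP Pg)) (P-normalizes SP t Pq)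
                  (NAll-normalizes t<k x-normalizes) [[g⁻¹,q⁻¹],x]∈C [[q,x⁻¹],g⁻¹]∈C)
              where
                Pq : P q
                Pq = X⊆P Xq
                [[g⁻¹,q⁻¹],x]∈C : IC P t ⁅ ⁅ g ⁻¹ , q ⁻¹ ⁆ , x ⁆
                [[g⁻¹,q⁻¹],x]∈C = comm-flip-mem (IC-sub t)
                  (comm-x-γ t (suc j) (PE.trans (PE.cong suc (PE.sym (+-suc j t))) j+1+t+1≡k)
                    (gen (g ⁻¹ , q ⁻¹ , γ-⁻¹ SP j g∈γ , IsSubgroup.⁻¹-mem SP Pq , refl)))
                [q,x⁻¹]∈C : IC P m ⁅ q , x ⁻¹ ⁆
                [q,x⁻¹]∈C = IC-resp m (sym (comm-⁻¹-flip q x))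
                  (Normalizer.stable⁻¹ (IC-resp m) (NAll-normalizes (n<1+n m) x-normalizes)
                    (proj₁ (agree m (n<1+n m)) (ICX.IC-elim m hx Xq)))
                [[q,x⁻¹],g⁻¹]∈C : IC P t ⁅ ⁅ q , x ⁻¹ ⁆ , g ⁻¹ ⁆
                [[q,x⁻¹],g⁻¹]∈C = comm-IC-γ SP j t (PE.subst (λ n → IC P n ⁅ q , x ⁻¹ ⁆) m≡j+1+t [q,x⁻¹]∈C)
                  (γ-⁻¹ SP j g∈γ)
            [x,g]∈NAll : NAll P (suc t) ⁅ x , g ⁆
            [x,g]∈NAll = comm-mem (ICP.NAll-sub (suc t)) (ICP.NAll-≤ (<⇒≤ t+1<k) x-normalizes)
              (ICP.P⊆NAll SP (suc t) Pg)
            [x,g]∈C^X : IC X (suc t) ⁅ x , g ⁆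
            [x,g]∈C^X = ICX.IC-intro t
              (proj₂ (NAll-transfer (suc t) (λ i i<t+1 → agree i (<-trans i<t+1 t+1<k))) [x,g]∈NAll)
              (λ Xq → proj₂ (agree t t<k) ([[x,g],q]∈C Xq))

      IC-X⊆IC-P : IC X (suc m) ⊆ IC P (suc m)
      IC-X⊆IC-P hx = ICP.IC-intro m (x-normalizes hx) (λ Pq → comm-x-γ hx m zero PE.refl (lift Pq))

lemma2p4 : {c ℓ x p : Level} (G : Group c ℓ) (k : ℕ) → 1 ≤ k
    → (X : Pred (Group.Carrier G) x) (P : Pred (Group.Carrier G) p)
    → GroupDefs.IsSubgroup G X → GroupDefs.IsSubgroup G P → X ⊆ P
    → (∀ i → i < k → GroupDefs.IC G X i ≐ GroupDefs.IC G P i)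
    → GroupDefs.⁅_⸴_⁆ G (GroupDefs.γ G P k) (GroupDefs.IC G X k) ⊆ GroupDefs.Triv G
    → GroupDefs.Centralizer G X ≐ GroupDefs.Centralizer G P
    → GroupDefs.IC G X k ≐ GroupDefs.IC G P k
lemma2p4 G zero () _ _ _ _ _ _ _ _
lemma2p4 G (suc m) _ X P _ SP X⊆P agree comm-trivial _ =
  IC-X⊆IC-P X⊆P m agree SP comm-trivial , IC-P⊆IC-X X⊆P m agree
  where open Transfer G X P
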